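{- For every $n\in\mathbb{N}$, \[ \mathcal{N}(n) = \frac{\operatorname{HW}(M(n))}{n+5} - (n+1)^2 , \] where $\mathcal{N}$ and $M$ are defined in the context.
   Context: $\operatorname{HW}(m)$ denotes the number of $1$'s in the binary representation of $m\in\mathbb{N}$. $\mathcal{N}(0)=0$ and for $n>0$, $\mathcal{N}(n)=|\{a\in\{0,\dots,n-1\}: a^2\equiv 1 \pmod n\}|$ (so $\mathcal{N}(1)=1$). For integers $q>1$, $t\ge 0$, $r\ge 0$ put $G_r(q,t)=\sum_{j=0}^{t-1} j^r q^j$. For $m\in\mathbb{N}$ set $t=m+1$, $u=m+5$, $q_1=2^{2u}$, $q_2=2^{2ut}$ and define \[ M(m)=\frac{2^{u}\,(2^{2ut^2}-1)}{2^u+1}-(2^u-1)\Big[G_4(q_1,t)G_0(q_2,t)-2G_2(q_1,t)G_0(q_2,t)-2m\,G_2(q_1,t)G_1(q_2,t)+m^2G_0(q_1,t)G_2(q_2,t)+2m\,G_0(q_1,t)G_1(q_2,t)\Big]. \] -}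

module Defs where

open import Data.Nat using (ℕ; zero; suc; _+_; _*_; _∸_; _^_)
open import Data.Nat.DivMod using (_/_; _%_)
open import Data.Nat.Properties using (_≟_)
open import Data.List using (List; upTo; filter; length)
open import Data.Integer using (ℤ; +_) renaming (_+_ to _+ℤ_; _*_ to _*ℤ_; _-_ to _-ℤ_)

-- Hamming weight: number of 1's in the binary representation.
-- hw fuel m strips fuel binary digits; m has at most m binary digits.
hw : ℕ → ℕ → ℕ
hw zero    m = 0
hw (suc f) m = m % 2 + hw f (m / 2)

HW : ℕ → ℕ
HW m = hw m m

𝒩 : ℕ → ℕ
𝒩 zero    = 0
𝒩 (suc k) = length (filter (λ a → ((a * a) % suc k) ≟ (1 % suc k)) (upTo (suc k)))

G : ℕ → ℕ → ℕ → ℕ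
G r q zero    = 0
G r q (suc t) = G r q t + (t ^ r) * (q ^ t)

-- M(m), as an integer.  The first term 2^u (2^{2ut²} - 1)/(2^u + 1) is an
-- exact division in ℕ (2^u + 1 divides (2^u)^{2t²} - 1).
M : ℕ → ℤ
M m = + ((2 ^ u * (2 ^ (2 * u * (t * t)) ∸ 1)) / suc (2 ^ u))
      -ℤ (+ (2 ^ u ∸ 1)) *ℤ
        ( ((((+ (G 4 q₁ t * G 0 q₂ t)
          -ℤ + (2 * G 2 q₁ t * G 0 q₂ t))
          -ℤ + (2 * m * G 2 q₁ t * G 1 q₂ t))
          +ℤ + (m * m * G 0 q₁ t * G 2 q₂ t))
          +ℤ + (2 * m * G 0 q₁ t * G 1 q₂ t)) )
  where
  t u q₁ q₂ : ℕ
  t = m + 1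
  u = m + 5
  q₁ = 2 ^ (2 * u)
  q₂ = 2 ^ (2 * u * t)

{-# OPTIONS --safe #-}
module Submission where

-- M(m) is the base-2^(2u) numeral whose digit at q₁^i q₂^j, for i, j ≤ m, is w (2^u + 1 − D²),
-- where w = 2^u − 1 and D = |i² − (1 + m j)|: expanding D² = (i² − 1 − m j)² and summing the
-- geometric series turns the G-products in M into exactly this double sum. Since D² ≤ 2^u these
-- are genuine digits: for D = 0 the digit is 2^(2u) − 1, of weight 2u, and otherwise it is
-- c + 2^u (w − c) with c = D² − 1, two complementary u-bit halves of total weight u. Hence
-- HW(M(m)) = u ((m + 1)² + #{(i, j) : i² = 1 + m j}), and for m ≥ 2 every i ≤ m with
-- i² ≡ 1 (mod m) has exactly one such j ≤ m, so the pairs number 𝒩(m).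

open import Defs
open import Data.Nat using (ℕ; zero; suc; ∣_-_∣; _+_; _*_; _^_; _∸_; _≤_; _<_; z≤n; s≤s; NonZero)
open import Data.Nat.Properties
open import Data.Nat.DivMod
  using (_%_; _/_; m≡m%n+[m/n]*n; m%n<n; m<n⇒m%n≡m; m*n%n≡0; [m+kn]%n≡m%n;
         m/n<m; m*n/n≡m; m<n*o⇒m/o<n; /-monoˡ-≤; +-distrib-/-∣ʳ)
open import Data.Nat.Divisibility using (n∣m*n)
open import Data.Nat.Tactic.RingSolver using (solve-∀)
open import Data.Nat.Solver using (module +-*-Solver)
open import Data.Integer using (+_) renaming (_+_ to _+ℤ_; _-_ to _-ℤ_; _*_ to _*ℤ_)
import Data.Integer.Properties as ℤ
open import Data.Integer.Tactic.RingSolver using () renaming (solve-∀ to ℤ-solve-∀)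
open import Algebra.Properties.CommutativeSemigroup +-commutativeSemigroup
  using () renaming (interchange to +-interchange)
open import Data.Empty using (⊥-elim)
open import Data.Bool using (true; false; if_then_else_)
open import Data.List using (length; filter; applyUpTo; _∷_)
open import Data.Sum using (inj₁; inj₂; [_,_]′)
open import Data.Product using (∃; _×_; _,_)
open import Function using (_∘_; id)
open import Relation.Nullary using (Dec; does; yes; no; ¬_; contradiction)
open import Relation.Unary as U using (Pred)
open import Relation.Binary.PropositionalEquality
  using (_≡_; _≢_; refl; sym; trans; cong; cong₂; subst; module ≡-Reasoning)

-- Hamming weight

data EvenOrOdd : ℕ → Set where
  even : ∀ n → EvenOrOdd (n * 2)
  odd  : ∀ n → EvenOrOdd (1 + n * 2)

evenOrOdd : ∀ n → EvenOrOdd n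
evenOrOdd zero = even zero
evenOrOdd (suc n) with evenOrOdd n
... | even k = odd k
... | odd k  = even (suc k)

odd≢even : ∀ m n → 1 + m * 2 ≢ n * 2
odd≢even zero    zero    ()
odd≢even zero    (suc n) ()
odd≢even (suc m) zero    ()
odd≢even (suc m) (suc n) eq = odd≢even m n (suc-injective (suc-injective eq))

hw-suc : ∀ f m → m ≤ f → hw (suc f) m ≡ hw f m
hw-suc zero    zero    z≤n = refl
hw-suc (suc f) zero    _   = refl
hw-suc (suc f) (suc m) m≤f =
  cong (_+_ (suc m % 2)) (hw-suc f (suc m / 2) (<⇒≤pred (<-≤-trans (m/n<m (suc m) 2 ≤-refl) m≤f)))

HW-fuel : ∀ {f m} → m ≤ f → hw f m ≡ HW m
HW-fuel {f} {m} m≤f = subst (λ g → hw g m ≡ HW m) (m∸n+n≡m m≤f) (extra (f ∸ m))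
  where
  extra : ∀ d → hw (d + m) m ≡ HW m
  extra zero    = refl
  extra (suc d) = trans (hw-suc (d + m) m (m≤n+m m d)) (extra d)

HW-step : ∀ m → HW m ≡ m % 2 + HW (m / 2)
HW-step zero    = refl
HW-step (suc m) = cong (_+_ (suc m % 2)) (HW-fuel (<⇒≤pred (m/n<m (suc m) 2 ≤-refl)))

HW-even : ∀ n → HW (n * 2) ≡ HW n
HW-even n = begin
  HW (n * 2)                       ≡⟨ HW-step (n * 2) ⟩
  n * 2 % 2 + HW (n * 2 / 2)       ≡⟨ cong₂ (λ r q → r + HW q) (m*n%n≡0 n 2) (m*n/n≡m n 2) ⟩
  HW n                             ∎
  where open ≡-Reasoning

HW-odd : ∀ n → HW (1 + n * 2) ≡ 1 + HW n
HW-odd n = begin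
  HW (1 + n * 2)                   ≡⟨ HW-step (1 + n * 2) ⟩
  (1 + n * 2) % 2 + HW ((1 + n * 2) / 2)
    ≡⟨ cong₂ (λ r q → r + HW q) ([m+kn]%n≡m%n 1 n 2)
             (trans (+-distrib-/-∣ʳ 1 {d = 2} (n∣m*n n)) (m*n/n≡m n 2)) ⟩
  1 + HW n                         ∎
  where open ≡-Reasoning

HW-bit : ∀ {r} n → r < 2 → HW (r + n * 2) ≡ r + HW n
HW-bit {0} n _ = HW-even n
HW-bit {1} n _ = HW-odd n
HW-bit {suc (suc _)} n (s≤s (s≤s ()))

HW-concat : ∀ p a b → a < 2 ^ p → HW (a + 2 ^ p * b) ≡ HW a + HW b
HW-concat zero    zero    b _ = cong HW (+-identityʳ b)
HW-concat zero    (suc _) b (s≤s ())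
HW-concat (suc p) a    b a<2^1+p = begin
  HW (a + 2 ^ suc p * b)                ≡⟨ cong HW split ⟩
  HW (a % 2 + (a / 2 + 2 ^ p * b) * 2)  ≡⟨ HW-bit (a / 2 + 2 ^ p * b) (m%n<n a 2) ⟩
  a % 2 + HW (a / 2 + 2 ^ p * b)        ≡⟨ cong (_+_ (a % 2)) (HW-concat p (a / 2) b a/2<2^p) ⟩
  a % 2 + (HW (a / 2) + HW b)           ≡⟨ +-assoc (a % 2) _ _ ⟨
  a % 2 + HW (a / 2) + HW b             ≡⟨ cong (_+ HW b) (HW-step a) ⟨
  HW a + HW b                           ∎
  where
  open ≡-Reasoning
  regroup : ∀ r h q b → r + h * 2 + 2 * q * b ≡ r + (h + q * b) * 2
  regroup = solve-∀
  split : a + 2 ^ suc p * b ≡ a % 2 + (a / 2 + 2 ^ p * b) * 2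
  split = trans (cong (_+ 2 ^ suc p * b) (m≡m%n+[m/n]*n a 2)) (regroup (a % 2) (a / 2) (2 ^ p) b)
  a/2<2^p : a / 2 < 2 ^ p
  a/2<2^p = m<n*o⇒m/o<n (subst (a <_) (*-comm 2 (2 ^ p)) a<2^1+p)

HW-complement : ∀ p c e → suc (c + e) ≡ 2 ^ p → HW c + HW e ≡ p
HW-complement zero    zero    zero    _ = refl
HW-complement zero    zero    (suc e) ()
HW-complement zero    (suc c) e       ()
HW-complement (suc p) c       e       c+e+1≡2^1+p = go (evenOrOdd c) (evenOrOdd e) c+e+1≡2^1+p
  where
  halve : ∀ {n} → n * 2 ≡ 2 * 2 ^ p → n ≡ 2 ^ p
  halve eq = *-cancelʳ-≡ _ _ 2 (trans eq (*-comm 2 (2 ^ p)))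
  even+even : ∀ c e → suc (c * 2 + e * 2) ≡ 1 + (c + e) * 2
  even+even = solve-∀
  even+odd : ∀ c e → suc (c * 2 + (1 + e * 2)) ≡ suc (c + e) * 2
  even+odd = solve-∀
  odd+even : ∀ c e → suc (1 + c * 2 + e * 2) ≡ suc (c + e) * 2
  odd+even = solve-∀
  odd+odd : ∀ c e → suc (1 + c * 2 + (1 + e * 2)) ≡ 1 + suc (c + e) * 2
  odd+odd = solve-∀
  go : ∀ {c e} → EvenOrOdd c → EvenOrOdd e → suc (c + e) ≡ 2 * 2 ^ p → HW c + HW e ≡ suc p
  go (even c) (even e) eq =
    ⊥-elim (odd≢even (c + e) (2 ^ p) (trans (sym (even+even c e)) (trans eq (*-comm 2 (2 ^ p)))))
  go (even c) (odd e) eq = begin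
    HW (c * 2) + HW (1 + e * 2)  ≡⟨ cong₂ _+_ (HW-even c) (HW-odd e) ⟩
    HW c + suc (HW e)            ≡⟨ +-suc (HW c) (HW e) ⟩
    suc (HW c + HW e)            ≡⟨ cong suc (HW-complement p c e (halve (trans (sym (even+odd c e)) eq))) ⟩
    suc p                        ∎
    where open ≡-Reasoning
  go (odd c) (even e) eq =
    trans (cong₂ _+_ (HW-odd c) (HW-even e))
          (cong suc (HW-complement p c e (halve (trans (sym (odd+even c e)) eq))))
  go (odd c) (odd e) eq =
    ⊥-elim (odd≢even (suc (c + e)) (2 ^ p) (trans (sym (odd+odd c e)) (trans eq (*-comm 2 (2 ^ p)))))

-- Finite sums and base-q expansions

∑ : ℕ → (ℕ → ℕ) → ℕ
∑ zero    f = 0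
∑ (suc n) f = ∑ n f + f n

infix 6.5 ∑
syntax ∑ n (λ i → e) = ∑[ i < n ] e

module _ {f g : ℕ → ℕ} where

  ∑-cong : ∀ n → (∀ i → i < n → f i ≡ g i) → ∑ n f ≡ ∑ n g
  ∑-cong zero    _ = refl
  ∑-cong (suc n) f≗g = cong₂ _+_ (∑-cong n (λ i i<n → f≗g i (m<n⇒m<1+n i<n))) (f≗g n ≤-refl)

  ∑-distrib-+ : ∀ n → ∑[ i < n ] (f i + g i) ≡ ∑ n f + ∑ n g
  ∑-distrib-+ zero    = refl
  ∑-distrib-+ (suc n) =
    trans (cong (_+ (f n + g n)) (∑-distrib-+ n)) (+-interchange (∑ n f) (∑ n g) (f n) (g n))

∑-const : ∀ n c → ∑[ i < n ] c ≡ n * c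
∑-const zero    c = refl
∑-const (suc n) c = trans (cong (_+ c) (∑-const n c)) (+-comm (n * c) c)

∑-zero : ∀ n {f} → (∀ i → i < n → f i ≡ 0) → ∑ n f ≡ 0
∑-zero n f≗0 = trans (∑-cong n f≗0) (trans (∑-const n 0) (*-zeroʳ n))

∑-distribˡ-* : ∀ c n (f : ℕ → ℕ) → c * ∑ n f ≡ ∑[ i < n ] c * f i
∑-distribˡ-* c zero    f = *-zeroʳ c
∑-distribˡ-* c (suc n) f = trans (*-distribˡ-+ c (∑ n f) (f n)) (cong (_+ c * f n) (∑-distribˡ-* c n f))

∑-head : ∀ n (f : ℕ → ℕ) → ∑ (suc n) f ≡ f 0 + ∑[ i < n ] f (suc i)
∑-head zero    f = sym (+-identityʳ (f 0))
∑-head (suc n) f = trans (cong (_+ f (suc n)) (∑-head n f)) (+-assoc (f 0) _ _)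

∑-comm : ∀ m n (f : ℕ → ℕ → ℕ) → ∑[ j < m ] ∑[ i < n ] f i j ≡ ∑[ i < n ] ∑[ j < m ] f i j
∑-comm zero    n f = sym (∑-zero n (λ _ _ → refl))
∑-comm (suc m) n f =
  trans (cong (_+ ∑[ i < n ] f i m) (∑-comm m n f)) (sym (∑-distrib-+ n))

eval : ℕ → ℕ → (ℕ → ℕ) → ℕ
eval q n d = ∑[ i < n ] d i * q ^ i

module _ (q n : ℕ) where

  eval-cong : ∀ {d e} → (∀ i → i < n → d i ≡ e i) → eval q n d ≡ eval q n e
  eval-cong d≗e = ∑-cong n (λ i i<n → cong (_* q ^ i) (d≗e i i<n))

  eval-+ : ∀ d e → eval q n (λ i → d i + e i) ≡ eval q n d + eval q n e
  eval-+ d e = trans (∑-cong n (λ i _ → *-distribʳ-+ (q ^ i) (d i) (e i))) (∑-distrib-+ n)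

  eval-*ˡ : ∀ c d → eval q n (λ i → c * d i) ≡ c * eval q n d
  eval-*ˡ c d = trans (∑-cong n (λ i _ → *-assoc c (d i) (q ^ i))) (sym (∑-distribˡ-* c n _))

  eval-*ʳ : ∀ d c → eval q n (λ i → d i * c) ≡ eval q n d * c
  eval-*ʳ d c = trans (eval-cong (λ i _ → *-comm (d i) c)) (trans (eval-*ˡ c d) (*-comm c _))

G≡eval : ∀ r q n → G r q n ≡ eval q n (_^ r)
G≡eval r q zero    = refl
G≡eval r q (suc n) = cong (_+ n ^ r * q ^ n) (G≡eval r q n)

G-geometric : ∀ q n → (q ∸ 1) * G 0 q n ≡ q ^ n ∸ 1
G-geometric zero    zero    = refl
G-geometric zero    (suc n) = refl
G-geometric (suc z) n       = cong (_∸ 1) (go n)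
  where
  regroup : ∀ z g s → 1 + z * (g + 1 * s) ≡ (1 + z * g) + z * s
  regroup = solve-∀
  go : ∀ n → 1 + z * G 0 (suc z) n ≡ suc z ^ n
  go zero    = cong suc (*-zeroʳ z)
  go (suc n) = trans (regroup z (G 0 (suc z) n) (suc z ^ n)) (cong (_+ z * suc z ^ n) (go n))

eval-< : ∀ q n d → (∀ i → i < n → d i < q) → eval q n d < q ^ n
eval-< q zero    d d<q = s≤s z≤n
eval-< q (suc n) d d<q =
  <-≤-trans (+-mono-<-≤ (eval-< q n d (λ i i<n → d<q i (m<n⇒m<1+n i<n))) ≤-refl)
            (*-monoˡ-≤ (q ^ n) (d<q n ≤-refl))

HW-eval : ∀ p n d → (∀ i → i < n → d i < 2 ^ p) → HW (eval (2 ^ p) n d) ≡ ∑[ i < n ] HW (d i)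
HW-eval p zero    d d<2^p = refl
HW-eval p (suc n) d d<2^p = begin
  HW (eval (2 ^ p) n d + d n * (2 ^ p) ^ n)   ≡⟨ cong (λ y → HW (eval (2 ^ p) n d + y)) shift ⟩
  HW (eval (2 ^ p) n d + 2 ^ (p * n) * d n)  ≡⟨ HW-concat (p * n) _ (d n) low<2^pn ⟩
  HW (eval (2 ^ p) n d) + HW (d n)           ≡⟨ cong (_+ HW (d n)) (HW-eval p n d d<2^p′) ⟩
  ∑[ i < n ] HW (d i) + HW (d n)             ∎
  where
  open ≡-Reasoning
  d<2^p′ : ∀ i → i < n → d i < 2 ^ p
  d<2^p′ i i<n = d<2^p i (m<n⇒m<1+n i<n)
  shift : d n * (2 ^ p) ^ n ≡ 2 ^ (p * n) * d n
  shift = trans (*-comm (d n) _) (cong (_* d n) (^-*-assoc 2 p n))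
  low<2^pn : eval (2 ^ p) n d < 2 ^ (p * n)
  low<2^pn = subst (eval (2 ^ p) n d <_) (^-*-assoc 2 p n) (eval-< (2 ^ p) n d d<2^p′)

-- Counting solutions of i² = 1 + m j

-- Through `does`, so that it computes in step with `filter`.
𝟙[_] : ∀ {a} {A : Set a} → Dec A → ℕ
𝟙[ A? ] = if does A? then 1 else 0

module _ {a} {A : Set a} where

  𝟙-yes : (A? : Dec A) → A → 𝟙[ A? ] ≡ 1
  𝟙-yes (yes _) _ = refl
  𝟙-yes (no ¬a) a = contradiction a ¬a

  𝟙-no : (A? : Dec A) → ¬ A → 𝟙[ A? ] ≡ 0
  𝟙-no (yes a) ¬a = contradiction a ¬a
  𝟙-no (no _)  _  = refl

𝟙-⇔ : ∀ {a b} {A : Set a} {B : Set b} → (A → B) → (B → A) →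
      (A? : Dec A) (B? : Dec B) → 𝟙[ A? ] ≡ 𝟙[ B? ]
𝟙-⇔ A→B B→A (yes a)  B? = sym (𝟙-yes B? (A→B a))
𝟙-⇔ A→B B→A (no ¬a) B? = sym (𝟙-no B? (¬a ∘ B→A))

length-filter-applyUpTo : ∀ {a p} {A : Set a} {P : Pred A p} (P? : U.Decidable P) (f : ℕ → A) n →
                          length (filter P? (applyUpTo f n)) ≡ ∑[ i < n ] 𝟙[ P? (f i) ]
length-filter-applyUpTo P? f zero    = refl
length-filter-applyUpTo P? f (suc n) = begin
  length (filter P? (f 0 ∷ applyUpTo (f ∘ suc) n))       ≡⟨ length-filter-∷ (f 0) _ ⟩
  𝟙[ P? (f 0) ] + length (filter P? (applyUpTo (f ∘ suc) n))
    ≡⟨ cong (_+_ (𝟙[ P? (f 0) ])) (length-filter-applyUpTo P? (f ∘ suc) n) ⟩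
  𝟙[ P? (f 0) ] + ∑[ i < n ] 𝟙[ P? (f (suc i)) ]      ≡⟨ ∑-head n _ ⟨
  ∑[ i < suc n ] 𝟙[ P? (f i) ]                           ∎
  where
  open ≡-Reasoning
  length-filter-∷ : ∀ x xs → length (filter P? (x ∷ xs)) ≡ 𝟙[ P? x ] + length (filter P? xs)
  length-filter-∷ x xs with does (P? x)
  ... | true  = refl
  ... | false = refl

module _ {p} {P : Pred ℕ p} (P? : U.Decidable P) where

  ∑-𝟙-none : ∀ n → (∀ j → j < n → ¬ P j) → ∑[ j < n ] 𝟙[ P? j ] ≡ 0
  ∑-𝟙-none n ¬P = ∑-zero n (λ j j<n → 𝟙-no (P? j) (¬P j j<n))

  ∑-𝟙-unique : ∀ {n} j₀ → j₀ < n → P j₀ → (∀ j → P j → j ≡ j₀) → ∑[ j < n ] 𝟙[ P? j ] ≡ 1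
  ∑-𝟙-unique {suc n} j₀ j₀<1+n Pj₀ unique with m<1+n⇒m<n∨m≡n j₀<1+n
  ... | inj₁ j₀<n = cong₂ _+_ (∑-𝟙-unique j₀ j₀<n Pj₀ unique)
                              (𝟙-no (P? n) (λ Pn → <-irrefl (sym (unique n Pn)) j₀<n))
  ... | inj₂ refl = cong₂ _+_ (∑-𝟙-none n (λ j j<n Pj → <-irrefl (unique j Pj) j<n))
                              (𝟙-yes (P? n) Pj₀)

∑-𝟙[≡1+m*j] : ∀ m .{{_ : NonZero m}} n a → 1 < m → a / m < n →
              ∑[ j < n ] 𝟙[ a ≟ 1 + m * j ] ≡ 𝟙[ a % m ≟ 1 % m ]
∑-𝟙[≡1+m*j] m n a 1<m a/m<n with a % m ≟ 1 % m
... | yes a%m≡1%m = trans (∑-𝟙-unique (λ j → a ≟ 1 + m * j) (a / m) a/m<n a≡1+m*[a/m] unique)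
                          (sym (𝟙-yes (a % m ≟ 1 % m) a%m≡1%m))
  where
  a≡1+m*[a/m] : a ≡ 1 + m * (a / m)
  a≡1+m*[a/m] = trans (m≡m%n+[m/n]*n a m)
                      (cong₂ _+_ (trans a%m≡1%m (m<n⇒m%n≡m 1<m)) (*-comm (a / m) m))
  unique : ∀ j → a ≡ 1 + m * j → j ≡ a / m
  unique j a≡1+m*j = *-cancelˡ-≡ j (a / m) m (suc-injective (trans (sym a≡1+m*j) a≡1+m*[a/m]))
... | no a%m≢1%m = trans (∑-𝟙-none (λ j → a ≟ 1 + m * j) n (λ j _ → a%m≢1%m ∘ a%m≡1%m))
                         (sym (𝟙-no (a % m ≟ 1 % m) a%m≢1%m))
  where
  a%m≡1%m : ∀ {j} → a ≡ 1 + m * j → a % m ≡ 1 % m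
  a%m≡1%m {j} a≡1+m*j = trans (cong (_% m) (trans a≡1+m*j (cong suc (*-comm m j)))) ([m+kn]%n≡m%n 1 j m)

pairCount : ℕ → ℕ → ℕ
pairCount m n = ∑[ j < n ] ∑[ i < n ] 𝟙[ i * i ≟ 1 + m * j ]

pairCount≡𝒩 : ∀ m → pairCount m (m + 1) ≡ 𝒩 m
pairCount≡𝒩 0 = refl
pairCount≡𝒩 1 = refl
pairCount≡𝒩 m@(suc (suc _)) = begin
  pairCount m (m + 1)                                      ≡⟨ cong (pairCount m) (+-comm m 1) ⟩
  ∑[ j < suc m ] ∑[ i < suc m ] 𝟙[ i * i ≟ 1 + m * j ]    ≡⟨ ∑-comm (suc m) (suc m) _ ⟩
  ∑[ i < suc m ] ∑[ j < suc m ] 𝟙[ i * i ≟ 1 + m * j ]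
    ≡⟨ ∑-cong (suc m) (λ i i<1+m →
         ∑-𝟙[≡1+m*j] m (suc m) (i * i) (s≤s (s≤s z≤n)) (i*i/m<1+m i<1+m)) ⟩
  ∑[ i < m ] 𝟙[ i * i % m ≟ 1 % m ] + 𝟙[ m * m % m ≟ 1 % m ]
    ≡⟨ cong (_+_ (∑[ i < m ] 𝟙[ i * i % m ≟ 1 % m ])) (𝟙-no (m * m % m ≟ 1 % m) m*m%m≢1) ⟩
  ∑[ i < m ] 𝟙[ i * i % m ≟ 1 % m ] + 0                    ≡⟨ +-identityʳ _ ⟩
  ∑[ i < m ] 𝟙[ i * i % m ≟ 1 % m ]                        ≡⟨ length-filter-applyUpTo _ id m ⟨
  𝒩 m                                                      ∎
  where
  open ≡-Reasoning
  i*i/m<1+m : ∀ {i} → i < suc m → i * i / m < suc m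
  i*i/m<1+m {i} i<1+m = s≤s (≤-trans (/-monoˡ-≤ m (*-mono-≤ i≤m i≤m)) (≤-reflexive (m*n/n≡m m m)))
    where
    i≤m : i ≤ m
    i≤m = m<1+n⇒m≤n i<1+m
  m*m%m≢1 : m * m % m ≢ 1 % m
  m*m%m≢1 eq = 0≢1+n (trans (sym (m*n%n≡0 m m)) eq)

-- Digits

∣m-n∣²+2mn≡m²+n² : ∀ m n → ∣ m - n ∣ * ∣ m - n ∣ + 2 * m * n ≡ m * m + n * n
∣m-n∣²+2mn≡m²+n² m n = [ ordered , reversed ]′ (≤-total m n)
  where
  open ≡-Reasoning
  ordered : ∀ {m n} → m ≤ n → ∣ m - n ∣ * ∣ m - n ∣ + 2 * m * n ≡ m * m + n * n
  ordered {m} m≤n with m≤n⇒∃[o]m+o≡n m≤n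
  ... | d , refl = subst (λ e → e * e + 2 * m * (m + d) ≡ m * m + (m + d) * (m + d))
                         (sym (∣m-m+n∣≡n m d)) (expand m d)
    where
    expand : ∀ m d → d * d + 2 * m * (m + d) ≡ m * m + (m + d) * (m + d)
    expand = solve-∀
  swap : ∀ m n → 2 * m * n ≡ 2 * n * m
  swap = solve-∀
  reversed : n ≤ m → ∣ m - n ∣ * ∣ m - n ∣ + 2 * m * n ≡ m * m + n * n
  reversed n≤m = begin
    ∣ m - n ∣ * ∣ m - n ∣ + 2 * m * n  ≡⟨ cong₂ (λ e f → e * e + f) (∣-∣-comm m n) (swap m n) ⟩
    ∣ n - m ∣ * ∣ n - m ∣ + 2 * n * m  ≡⟨ ordered n≤m ⟩
    n * n + m * m                      ≡⟨ +-comm (n * n) (m * m) ⟩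
    m * m + n * n                      ∎

w*[1+w∸c]≡c+[1+w]*[w∸c] : ∀ {w c} → c ≤ w → w * (suc w ∸ c) ≡ c + suc w * (w ∸ c)
w*[1+w∸c]≡c+[1+w]*[w∸c] {c = c} c≤w with m≤n⇒∃[o]m+o≡n c≤w
... | e , refl = begin
  (c + e) * (suc (c + e) ∸ c)
    ≡⟨ cong ((c + e) *_) (trans (cong (_∸ c) (sym (+-suc c e))) (m+n∸m≡n c (suc e))) ⟩
  (c + e) * suc e                  ≡⟨ expand c e ⟩
  c + suc (c + e) * e              ≡⟨ cong (λ e′ → c + suc (c + e) * e′) (m+n∸m≡n c e) ⟨
  c + suc (c + e) * (c + e ∸ c)    ∎
  where
  open ≡-Reasoning
  expand : ∀ c e → (c + e) * suc e ≡ c + suc (c + e) * e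
  expand = solve-∀

[1+m²]²≤2^[m+5] : ∀ m → (1 + m * m) * (1 + m * m) ≤ 2 ^ (m + 5)
[1+m²]²≤2^[m+5] 0 = ≤ᵇ⇒≤ _ _ _
[1+m²]²≤2^[m+5] 1 = ≤ᵇ⇒≤ _ _ _
[1+m²]²≤2^[m+5] 2 = ≤ᵇ⇒≤ _ _ _
[1+m²]²≤2^[m+5] 3 = ≤ᵇ⇒≤ _ _ _
[1+m²]²≤2^[m+5] 4 = ≤ᵇ⇒≤ _ _ _
[1+m²]²≤2^[m+5] 5 = ≤ᵇ⇒≤ _ _ _
[1+m²]²≤2^[m+5] (suc (suc (suc (suc (suc (suc k)))))) = from6 k
  where
  f : ℕ → ℕ
  f m = (1 + m * m) * (1 + m * m)
  -- (1 + m²)² at most doubles from m to m + 1 once m ≥ 6.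
  doubling : ∀ k → 2 * ((1 + (6 + k) * (6 + k)) * (1 + (6 + k) * (6 + k)))
                 ≡ (1 + (7 + k) * (7 + k)) * (1 + (7 + k) * (7 + k))
                   + (238 + 376 * k + 140 * k * k + 20 * k * k * k + k * k * k * k)
  doubling = solve-∀
  from6 : ∀ k → f (6 + k) ≤ 2 ^ (6 + k + 5)
  from6 zero    = ≤ᵇ⇒≤ _ _ _
  from6 (suc k) = ≤-trans (≤-trans (m≤m+n _ _) (≤-reflexive (sym (doubling k)))) (*-monoʳ-≤ 2 (from6 k))

module Block (p : ℕ) where

  x w : ℕ
  x = 2 ^ p
  w = x ∸ 1

  -- block 0 = 2^(2p) − 1, and for 1 ≤ D² ≤ x, block D = c + x (w − c) with c = D² − 1,
  -- two p-bit halves that are bitwise complements.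
  block : ℕ → ℕ
  block D = w * (suc x ∸ D * D)

  x≡1+w : x ≡ suc w
  x≡1+w = sym (trans (+-comm 1 w) (m∸n+n≡m (m^n>0 2 p)))

  2^2p≡1+w*[1+x] : 2 ^ (2 * p) ≡ suc (w * suc x)
  2^2p≡1+w*[1+x] = begin
    2 ^ (2 * p)             ≡⟨ cong (λ k → 2 ^ (p + k)) (+-identityʳ p) ⟩
    2 ^ (p + p)             ≡⟨ ^-distribˡ-+-* 2 p p ⟩
    x * x                   ≡⟨ cong (λ y → y * y) x≡1+w ⟩
    suc w * suc w           ≡⟨ square w ⟩
    suc (w * suc (suc w))   ≡⟨ cong (λ y → suc (w * suc y)) x≡1+w ⟨
    suc (w * suc x)         ∎
    where
    open ≡-Reasoning
    square : ∀ w → suc w * suc w ≡ suc (w * suc (suc w))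
    square = solve-∀

  block<2^2p : ∀ D → block D < 2 ^ (2 * p)
  block<2^2p D = subst (block D <_) (sym 2^2p≡1+w*[1+x]) (s≤s (*-monoʳ-≤ w (m∸n≤m (suc x) (D * D))))

  HW-block : ∀ D → D * D ≤ x → HW (block D) ≡ p * (1 + 𝟙[ D ≟ 0 ])
  HW-block zero _ = begin
    HW (w * suc x)    ≡⟨ cong HW (trans (*-suc w x) (cong (_+_ w) (*-comm w x))) ⟩
    HW (w + x * w)    ≡⟨ HW-concat p w w (subst (w <_) (sym x≡1+w) ≤-refl) ⟩
    HW w + HW w       ≡⟨ cong₂ _+_ HW-w HW-w ⟩
    p + p             ≡⟨ double p ⟩
    p * 2             ∎
    where
    open ≡-Reasoning
    HW-w : HW w ≡ p
    HW-w = HW-complement p 0 w (sym x≡1+w)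
    double : ∀ p → p + p ≡ p * 2
    double = solve-∀
  HW-block (suc d) c<x = begin
    HW (w * (x ∸ c))        ≡⟨ cong HW (subst (λ y → w * (y ∸ c) ≡ c + y * (w ∸ c)) (sym x≡1+w)
                                               (w*[1+w∸c]≡c+[1+w]*[w∸c] c≤w)) ⟩
    HW (c + x * (w ∸ c))    ≡⟨ HW-concat p c (w ∸ c) c<x ⟩
    HW c + HW (w ∸ c)
      ≡⟨ HW-complement p c (w ∸ c) (trans (cong suc (m+[n∸m]≡n c≤w)) (sym x≡1+w)) ⟩
    p                       ≡⟨ *-identityʳ p ⟨
    p * 1                   ∎
    where
    open ≡-Reasoning
    -- suc d * suc d reduces to suc c, so the hypothesis D * D ≤ x is c < x.
    c : ℕ
    c = d + d * suc d
    c≤w : c ≤ w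
    c≤w = m<1+n⇒m≤n (subst (c <_) x≡1+w c<x)

  block-balance : ∀ D {Q P} → D * D ≤ x → D * D + Q ≡ 1 + P → x * w + w * Q ≡ block D + w * P
  block-balance D {Q} {P} D²≤x D²+Q≡1+P = +-cancelʳ-≡ (w * s) _ _ (begin
    x * w + w * Q + w * s   ≡⟨ gather x w Q s ⟩
    x * w + w * (s + Q)     ≡⟨ cong (λ z → x * w + w * z) D²+Q≡1+P ⟩
    x * w + w * (1 + P)     ≡⟨ regroup x w P ⟩
    w * suc x + w * P       ≡⟨ cong (λ z → w * z + w * P) (m∸n+n≡m (m≤n⇒m≤1+n D²≤x)) ⟨
    w * (k + s) + w * P     ≡⟨ spread w k s P ⟩
    block D + w * P + w * s ∎)
    where
    open ≡-Reasoning
    s k : ℕ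
    s = D * D
    k = suc x ∸ s
    gather : ∀ x w Q s → x * w + w * Q + w * s ≡ x * w + w * (s + Q)
    gather = solve-∀
    regroup : ∀ x w P → x * w + w * (1 + P) ≡ w * suc x + w * P
    regroup = solve-∀
    spread : ∀ w k s P → w * (k + s) + w * P ≡ w * k + w * P + w * s
    spread = solve-∀

-- The numeral M(m)

infixl 6 _⊕_
infixr 6.5 _⊛_

_⊕_ : (ℕ → ℕ → ℕ) → (ℕ → ℕ → ℕ) → ℕ → ℕ → ℕ
(f ⊕ g) i j = f i j + g i j

_⊛_ : ℕ → (ℕ → ℕ → ℕ) → ℕ → ℕ → ℕ
(c ⊛ f) i j = c * f i j

μ : ℕ → ℕ → ℕ → ℕ → ℕ
μ a b i j = i ^ a * j ^ b

module Moments (q₁ q₂ n : ℕ) where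

  ⟪_⟫ : (ℕ → ℕ → ℕ) → ℕ
  ⟪ f ⟫ = eval q₂ n (λ j → eval q₁ n (λ i → f i j))

  ⟪⟫-cong : ∀ {f g} → (∀ i j → i < n → j < n → f i j ≡ g i j) → ⟪ f ⟫ ≡ ⟪ g ⟫
  ⟪⟫-cong f≗g = eval-cong q₂ n (λ j j<n → eval-cong q₁ n (λ i i<n → f≗g i j i<n j<n))

  ⟪⟫-+ : ∀ f g → ⟪ f ⊕ g ⟫ ≡ ⟪ f ⟫ + ⟪ g ⟫
  ⟪⟫-+ f g = trans (eval-cong q₂ n (λ j _ → eval-+ q₁ n (λ i → f i j) (λ i → g i j)))
                    (eval-+ q₂ n (λ j → eval q₁ n (λ i → f i j)) (λ j → eval q₁ n (λ i → g i j)))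

  ⟪⟫-* : ∀ c f → ⟪ c ⊛ f ⟫ ≡ c * ⟪ f ⟫
  ⟪⟫-* c f = trans (eval-cong q₂ n (λ j _ → eval-*ˡ q₁ n c (λ i → f i j)))
                    (eval-*ˡ q₂ n c (λ j → eval q₁ n (λ i → f i j)))

  G*G≡⟪μ⟫ : ∀ a b → G a q₁ n * G b q₂ n ≡ ⟪ μ a b ⟫
  G*G≡⟪μ⟫ a b = begin
    G a q₁ n * G b q₂ n                            ≡⟨ cong₂ _*_ (G≡eval a q₁ n) (G≡eval b q₂ n) ⟩
    eval q₁ n (_^ a) * eval q₂ n (_^ b)            ≡⟨ eval-*ˡ q₂ n (eval q₁ n (_^ a)) (_^ b) ⟨
    eval q₂ n (λ j → eval q₁ n (_^ a) * j ^ b)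
      ≡⟨ eval-cong q₂ n (λ j _ → eval-*ʳ q₁ n (_^ a) (j ^ b)) ⟨
    ⟪ μ a b ⟫                                      ∎
    where open ≡-Reasoning

  c*G*G≡c*⟪μ⟫ : ∀ c a b → c * G a q₁ n * G b q₂ n ≡ c * ⟪ μ a b ⟫
  c*G*G≡c*⟪μ⟫ c a b = trans (*-assoc c _ _) (cong (c *_) (G*G≡⟪μ⟫ a b))

+-balance : ∀ a w k p₁ p₂ p₃ n₁ n₂ → a + w * (n₁ + n₂) ≡ k + w * (p₁ + p₂ + p₃) →
            + a -ℤ + w *ℤ ((((+ p₁ -ℤ + n₁) -ℤ + n₂) +ℤ + p₂) +ℤ + p₃) ≡ + k
+-balance a w k p₁ p₂ p₃ n₁ n₂ balanced = begin
  + a -ℤ + w *ℤ ((((+ p₁ -ℤ + n₁) -ℤ + n₂) +ℤ + p₂) +ℤ + p₃)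
    ≡⟨ separate (+ a) (+ w) (+ p₁) (+ p₂) (+ p₃) (+ n₁) (+ n₂) ⟩
  (+ a +ℤ + w *ℤ (+ n₁ +ℤ + n₂)) -ℤ + w *ℤ (+ p₁ +ℤ + p₂ +ℤ + p₃)
    ≡⟨ cong₂ _-ℤ_ (sym cast-a+w*n) (sym cast-w*p) ⟩
  + (a + w * (n₁ + n₂)) -ℤ + (w * (p₁ + p₂ + p₃))
    ≡⟨ cong (λ z → + z -ℤ + (w * (p₁ + p₂ + p₃))) balanced ⟩
  + (k + w * (p₁ + p₂ + p₃)) -ℤ + (w * (p₁ + p₂ + p₃))
    ≡⟨ cong (λ z → z -ℤ + (w * (p₁ + p₂ + p₃))) (ℤ.pos-+ k _) ⟩
  (+ k +ℤ + (w * (p₁ + p₂ + p₃))) -ℤ + (w * (p₁ + p₂ + p₃))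
    ≡⟨ cancel (+ k) (+ (w * (p₁ + p₂ + p₃))) ⟩
  + k ∎
  where
  open ≡-Reasoning
  separate : ∀ a w p₁ p₂ p₃ n₁ n₂ → a -ℤ w *ℤ ((((p₁ -ℤ n₁) -ℤ n₂) +ℤ p₂) +ℤ p₃)
                                    ≡ (a +ℤ w *ℤ (n₁ +ℤ n₂)) -ℤ w *ℤ (p₁ +ℤ p₂ +ℤ p₃)
  separate = ℤ-solve-∀
  cancel : ∀ k y → (k +ℤ y) -ℤ y ≡ k
  cancel = ℤ-solve-∀
  cast-a+w*n : + (a + w * (n₁ + n₂)) ≡ + a +ℤ + w *ℤ (+ n₁ +ℤ + n₂)
  cast-a+w*n = trans (ℤ.pos-+ a _) (cong (_+ℤ_ (+ a))
                 (trans (ℤ.pos-* w _) (cong (_*ℤ_ (+ w)) (ℤ.pos-+ n₁ n₂))))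
  cast-w*p : + (w * (p₁ + p₂ + p₃)) ≡ + w *ℤ (+ p₁ +ℤ + p₂ +ℤ + p₃)
  cast-w*p = trans (ℤ.pos-* w _) (cong (_*ℤ_ (+ w))
               (trans (ℤ.pos-+ (p₁ + p₂) p₃) (cong (λ z → z +ℤ + p₃) (ℤ.pos-+ p₁ p₂))))

module Construction (m : ℕ) where

  t u q₁ q₂ : ℕ
  t = m + 1
  u = m + 5
  q₁ = 2 ^ (2 * u)
  q₂ = 2 ^ (2 * u * t)

  open Block u
  open Moments q₁ q₂ t

  dist : ℕ → ℕ → ℕ
  dist i j = ∣ i * i - (1 + m * j) ∣

  digit : ℕ → ℕ → ℕ
  digit i j = block (dist i j)

  K : ℕ
  K = ⟪ digit ⟫

  <t⇒≤m : ∀ {i} → i < t → i ≤ m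
  <t⇒≤m {i} i<t = m<1+n⇒m≤n (subst (i <_) (+-comm m 1) i<t)

  dist²≤x : ∀ {i j} → i < t → j < t → dist i j * dist i j ≤ x
  dist²≤x {i} {j} i<t j<t = ≤-trans (*-mono-≤ dist≤1+m² dist≤1+m²) ([1+m²]²≤2^[m+5] m)
    where
    i≤m : i ≤ m
    i≤m = <t⇒≤m i<t
    dist≤1+m² : dist i j ≤ 1 + m * m
    dist≤1+m² = ≤-trans (∣m-n∣≤m⊔n (i * i) (1 + m * j))
                        (⊔-lub (m≤n⇒m≤1+n (*-mono-≤ i≤m i≤m)) (s≤s (*-monoʳ-≤ m (<t⇒≤m j<t))))

  HW-K : HW K ≡ u * (t ^ 2 + pairCount m t)
  HW-K = begin
    HW K
      ≡⟨ HW-eval (2 * u * t) t rows rows<q₂ ⟩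
    ∑[ j < t ] HW (rows j)
      ≡⟨ ∑-cong t (λ j _ → HW-eval (2 * u) t (λ i → digit i j) (λ i _ → block<2^2p (dist i j))) ⟩
    ∑[ j < t ] ∑[ i < t ] HW (digit i j)
      ≡⟨ ∑-cong t (λ j j<t → ∑-cong t (λ i i<t → HW-digit i<t j<t)) ⟩
    ∑[ j < t ] ∑[ i < t ] u * (1 + 𝟙[ i * i ≟ 1 + m * j ])
      ≡⟨ factor ⟨
    u * (∑[ j < t ] ∑[ i < t ] (1 + 𝟙[ i * i ≟ 1 + m * j ]))
      ≡⟨ cong (u *_) count ⟩
    u * (t ^ 2 + pairCount m t)
      ∎
    where
    open ≡-Reasoning
    rows : ℕ → ℕ
    rows j = eval q₁ t (λ i → digit i j)
    rows<q₂ : ∀ j → j < t → rows j < q₂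
    rows<q₂ j _ = subst (rows j <_) (^-*-assoc 2 (2 * u) t) (eval-< q₁ t _ (λ i _ → block<2^2p (dist i j)))
    HW-digit : ∀ {i j} → i < t → j < t → HW (digit i j) ≡ u * (1 + 𝟙[ i * i ≟ 1 + m * j ])
    HW-digit {i} {j} i<t j<t = trans (HW-block (dist i j) (dist²≤x i<t j<t))
      (cong (λ b → u * (1 + b))
            (𝟙-⇔ ∣m-n∣≡0⇒m≡n m≡n⇒∣m-n∣≡0 (dist i j ≟ 0) (i * i ≟ 1 + m * j)))
    factor : u * (∑[ j < t ] ∑[ i < t ] (1 + 𝟙[ i * i ≟ 1 + m * j ]))
             ≡ ∑[ j < t ] ∑[ i < t ] u * (1 + 𝟙[ i * i ≟ 1 + m * j ])
    factor = trans (∑-distribˡ-* u t _) (∑-cong t (λ j _ → ∑-distribˡ-* u t _))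
    count : ∑[ j < t ] ∑[ i < t ] (1 + 𝟙[ i * i ≟ 1 + m * j ]) ≡ t ^ 2 + pairCount m t
    count = trans (∑-cong t (λ j _ → trans (∑-distrib-+ t)
                                             (cong (_+ ∑[ i < t ] 𝟙[ i * i ≟ 1 + m * j ]) (∑-const t 1))))
                  (trans (∑-distrib-+ t) (cong (_+ pairCount m t) (∑-const t (t * 1))))

  pointwise : ∀ {i j} → i < t → j < t →
              (x * w ⊛ μ 0 0 ⊕ w ⊛ (2 ⊛ μ 2 0 ⊕ 2 * m ⊛ μ 2 1)) i j
              ≡ (digit ⊕ w ⊛ (μ 4 0 ⊕ m * m ⊛ μ 0 2 ⊕ 2 * m ⊛ μ 0 1)) i j
  pointwise {i} {j} i<t j<t = begin
    x * w * μ 0 0 i j + w * (2 * μ 2 0 i j + 2 * m * μ 2 1 i j)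
      ≡⟨ lhs x w m i j ⟩
    x * w + w * (2 * (i * i) * (1 + m * j))
      ≡⟨ block-balance (dist i j) (dist²≤x i<t j<t) dist²+Q≡1+P ⟩
    digit i j + w * ((i * i) * (i * i) + m * m * (j * j) + 2 * m * j)
      ≡⟨ cong (λ z → digit i j + w * z) (rhs m i j) ⟩
    digit i j + w * (μ 4 0 i j + m * m * μ 0 2 i j + 2 * m * μ 0 1 i j)  ∎
    where
    open ≡-Reasoning
    -- Data.Nat.Tactic.RingSolver rejects _^_, so these two use the syntactic solver.
    open +-*-Solver using (solve; _:+_; _:*_; _:^_; _:=_; con)
    lhs : ∀ x w m i j → x * w * (i ^ 0 * j ^ 0) + w * (2 * (i ^ 2 * j ^ 0) + 2 * m * (i ^ 2 * j ^ 1))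
                        ≡ x * w + w * (2 * (i * i) * (1 + m * j))
    lhs = solve 5 (λ x w m i j →
      x :* w :* (i :^ 0 :* j :^ 0) :+ w :* (con 2 :* (i :^ 2 :* j :^ 0) :+ con 2 :* m :* (i :^ 2 :* j :^ 1))
      := x :* w :+ w :* (con 2 :* (i :* i) :* (con 1 :+ m :* j))) refl
    rhs : ∀ m i j → (i * i) * (i * i) + m * m * (j * j) + 2 * m * j
                    ≡ i ^ 4 * j ^ 0 + m * m * (i ^ 0 * j ^ 2) + 2 * m * (i ^ 0 * j ^ 1)
    rhs = solve 3 (λ m i j →
      (i :* i) :* (i :* i) :+ m :* m :* (j :* j) :+ con 2 :* m :* j
      := i :^ 4 :* j :^ 0 :+ m :* m :* (i :^ 0 :* j :^ 2) :+ con 2 :* m :* (i :^ 0 :* j :^ 1)) refl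
    expand : ∀ a m j → a * a + (1 + m * j) * (1 + m * j) ≡ 1 + (a * a + m * m * (j * j) + 2 * m * j)
    expand = solve-∀
    dist²+Q≡1+P : dist i j * dist i j + 2 * (i * i) * (1 + m * j)
                  ≡ 1 + ((i * i) * (i * i) + m * m * (j * j) + 2 * m * j)
    dist²+Q≡1+P = trans (∣m-n∣²+2mn≡m²+n² (i * i) (1 + m * j)) (expand (i * i) m j)

  S₁ S₂ : ℕ
  S₁ = G 0 q₁ t
  S₂ = G 0 q₂ t

  2^[2ut²]∸1 : 2 ^ (2 * u * (t * t)) ∸ 1 ≡ w * suc x * S₁ * S₂
  2^[2ut²]∸1 = begin
    2 ^ (2 * u * (t * t)) ∸ 1   ≡⟨ cong (λ e → 2 ^ e ∸ 1) (*-assoc (2 * u) t t) ⟨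
    2 ^ (2 * u * t * t) ∸ 1     ≡⟨ cong (_∸ 1) (^-*-assoc 2 (2 * u * t) t) ⟨
    q₂ ^ t ∸ 1                  ≡⟨ G-geometric q₂ t ⟨
    (q₂ ∸ 1) * S₂               ≡⟨ cong (λ y → (y ∸ 1) * S₂) (^-*-assoc 2 (2 * u) t) ⟨
    (q₁ ^ t ∸ 1) * S₂           ≡⟨ cong (_* S₂) (G-geometric q₁ t) ⟨
    (q₁ ∸ 1) * S₁ * S₂          ≡⟨ cong (λ y → (y ∸ 1) * S₁ * S₂) 2^2p≡1+w*[1+x] ⟩
    w * suc x * S₁ * S₂         ∎
    where open ≡-Reasoning

  A : ℕ
  A = (x * (2 ^ (2 * u * (t * t)) ∸ 1)) / suc x

  A≡x*w*⟪μ00⟫ : A ≡ x * w * ⟪ μ 0 0 ⟫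
  A≡x*w*⟪μ00⟫ = begin
    x * (2 ^ (2 * u * (t * t)) ∸ 1) / suc x   ≡⟨ cong (λ y → x * y / suc x) 2^[2ut²]∸1 ⟩
    x * (w * suc x * S₁ * S₂) / suc x         ≡⟨ cong (_/ suc x) (shuffle x w S₁ S₂) ⟩
    x * w * (S₁ * S₂) * suc x / suc x         ≡⟨ m*n/n≡m (x * w * (S₁ * S₂)) (suc x) ⟩
    x * w * (S₁ * S₂)                         ≡⟨ cong (x * w *_) (G*G≡⟪μ⟫ 0 0) ⟩
    x * w * ⟪ μ 0 0 ⟫                         ∎
    where
    open ≡-Reasoning
    shuffle : ∀ x w a b → x * (w * suc x * a * b) ≡ x * w * (a * b) * suc x
    shuffle = solve-∀

  -- M m unfolds to + A -ℤ + w *ℤ ((((+ P₁ -ℤ + N₁) -ℤ + N₂) +ℤ + P₂) +ℤ + P₃).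
  P₁ P₂ P₃ N₁ N₂ : ℕ
  P₁ = G 4 q₁ t * G 0 q₂ t
  P₂ = m * m * G 0 q₁ t * G 2 q₂ t
  P₃ = 2 * m * G 0 q₁ t * G 1 q₂ t
  N₁ = 2 * G 2 q₁ t * G 0 q₂ t
  N₂ = 2 * m * G 2 q₁ t * G 1 q₂ t

  balanced : A + w * (N₁ + N₂) ≡ K + w * (P₁ + P₂ + P₃)
  balanced = begin
    A + w * (N₁ + N₂)
      ≡⟨ cong₂ (λ a z → a + w * z) A≡x*w*⟪μ00⟫
               (cong₂ _+_ (c*G*G≡c*⟪μ⟫ 2 2 0) (c*G*G≡c*⟪μ⟫ (2 * m) 2 1)) ⟩
    x * w * ⟪ μ 0 0 ⟫ + w * (2 * ⟪ μ 2 0 ⟫ + 2 * m * ⟪ μ 2 1 ⟫)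
      ≡⟨ split-lhs ⟨
    ⟪ x * w ⊛ μ 0 0 ⊕ w ⊛ (2 ⊛ μ 2 0 ⊕ 2 * m ⊛ μ 2 1) ⟫
      ≡⟨ ⟪⟫-cong (λ i j i<t j<t → pointwise i<t j<t) ⟩
    ⟪ digit ⊕ w ⊛ (μ 4 0 ⊕ m * m ⊛ μ 0 2 ⊕ 2 * m ⊛ μ 0 1) ⟫
      ≡⟨ split-rhs ⟩
    K + w * (⟪ μ 4 0 ⟫ + m * m * ⟪ μ 0 2 ⟫ + 2 * m * ⟪ μ 0 1 ⟫)
      ≡⟨ cong (λ z → K + w * z) (cong₂ _+_ (cong₂ _+_ (G*G≡⟪μ⟫ 4 0) (c*G*G≡c*⟪μ⟫ (m * m) 0 2))
                                            (c*G*G≡c*⟪μ⟫ (2 * m) 0 1)) ⟨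
    K + w * (P₁ + P₂ + P₃)  ∎
    where
    open ≡-Reasoning
    split-lhs : ⟪ x * w ⊛ μ 0 0 ⊕ w ⊛ (2 ⊛ μ 2 0 ⊕ 2 * m ⊛ μ 2 1) ⟫
                ≡ x * w * ⟪ μ 0 0 ⟫ + w * (2 * ⟪ μ 2 0 ⟫ + 2 * m * ⟪ μ 2 1 ⟫)
    split-lhs = begin
      ⟪ x * w ⊛ μ 0 0 ⊕ w ⊛ Q ⟫          ≡⟨ ⟪⟫-+ (x * w ⊛ μ 0 0) (w ⊛ Q) ⟩
      ⟪ x * w ⊛ μ 0 0 ⟫ + ⟪ w ⊛ Q ⟫      ≡⟨ cong₂ _+_ (⟪⟫-* (x * w) (μ 0 0)) (⟪⟫-* w Q) ⟩
      x * w * ⟪ μ 0 0 ⟫ + w * ⟪ Q ⟫      ≡⟨ cong (λ z → x * w * ⟪ μ 0 0 ⟫ + w * z) Q-split ⟩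
      x * w * ⟪ μ 0 0 ⟫ + w * (2 * ⟪ μ 2 0 ⟫ + 2 * m * ⟪ μ 2 1 ⟫)  ∎
      where
      Q : ℕ → ℕ → ℕ
      Q = 2 ⊛ μ 2 0 ⊕ 2 * m ⊛ μ 2 1
      Q-split : ⟪ Q ⟫ ≡ 2 * ⟪ μ 2 0 ⟫ + 2 * m * ⟪ μ 2 1 ⟫
      Q-split = trans (⟪⟫-+ (2 ⊛ μ 2 0) (2 * m ⊛ μ 2 1))
                      (cong₂ _+_ (⟪⟫-* 2 (μ 2 0)) (⟪⟫-* (2 * m) (μ 2 1)))
    split-rhs : ⟪ digit ⊕ w ⊛ (μ 4 0 ⊕ m * m ⊛ μ 0 2 ⊕ 2 * m ⊛ μ 0 1) ⟫
                ≡ K + w * (⟪ μ 4 0 ⟫ + m * m * ⟪ μ 0 2 ⟫ + 2 * m * ⟪ μ 0 1 ⟫)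
    split-rhs = begin
      ⟪ digit ⊕ w ⊛ P ⟫    ≡⟨ ⟪⟫-+ digit (w ⊛ P) ⟩
      K + ⟪ w ⊛ P ⟫        ≡⟨ cong (_+_ K) (⟪⟫-* w P) ⟩
      K + w * ⟪ P ⟫        ≡⟨ cong (λ z → K + w * z) P-split ⟩
      K + w * (⟪ μ 4 0 ⟫ + m * m * ⟪ μ 0 2 ⟫ + 2 * m * ⟪ μ 0 1 ⟫)  ∎
      where
      P : ℕ → ℕ → ℕ
      P = μ 4 0 ⊕ m * m ⊛ μ 0 2 ⊕ 2 * m ⊛ μ 0 1
      P-split : ⟪ P ⟫ ≡ ⟪ μ 4 0 ⟫ + m * m * ⟪ μ 0 2 ⟫ + 2 * m * ⟪ μ 0 1 ⟫
      P-split = trans (⟪⟫-+ (μ 4 0 ⊕ m * m ⊛ μ 0 2) (2 * m ⊛ μ 0 1))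
                  (cong₂ _+_ (trans (⟪⟫-+ (μ 4 0) (m * m ⊛ μ 0 2))
                                    (cong (_+_ ⟪ μ 4 0 ⟫) (⟪⟫-* (m * m) (μ 0 2))))
                             (⟪⟫-* (2 * m) (μ 0 1)))

  M≡K : M m ≡ + K
  M≡K = +-balance A w K P₁ P₂ P₃ N₁ N₂ balanced

mainTheorem5 : (n : ℕ) → ∃ λ k → (M n ≡ + k) × (HW k ≡ (n + 5) * (𝒩 n + (n + 1) ^ 2))
mainTheorem5 n = K , M≡K , (begin
  HW K                          ≡⟨ HW-K ⟩
  u * (t ^ 2 + pairCount n t)   ≡⟨ cong (λ c → u * (t ^ 2 + c)) (pairCount≡𝒩 n) ⟩
  u * (t ^ 2 + 𝒩 n)             ≡⟨ cong (u *_) (+-comm (t ^ 2) (𝒩 n)) ⟩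
  u * (𝒩 n + t ^ 2)             ∎)
  where
  open Construction n
  open ≡-Reasoning
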